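{- For all integers $p,q\ge0$, the triples $(p,1,q)$ and $(p,2,q)$ are cactus-compatible.
   Context: Posets are finite. For a poset $X$ with $|X|=N$, a linear extension is a bijection $f:X\to\{1,\ldots,N\}$ with $f(a)<f(b)$ whenever $a<_X b$. For $1\le i\le N-1$ the Bender–Knuth involution $t_i$ acts on linear extensions of $X$ by swapping labels $i$ and $i+1$ if $f^{ -1}(i)$, $f^{ -1}(i+1)$ are incomparable, and leaving $f$ unchanged otherwise. Products denote composition, rightmost factor first. $q_0=\mathrm{id}$, $q_i=t_1(t_2t_1)\cdots(t_it_{i-1}\cdots t_1)$, $q_{jk}=q_{k-1}q_{k-j}q_{k-1}$ for $j<k$. Ordinal sum $X\oplus Y$: all of $X$ below all of $Y$. $\mathfrak{D}_1=\{C_1\}$ (the one-element poset) and $\mathfrak{D}_2=\{C_1+C_1\}$ (the two-element antichain). A triple $(p,n,q)$ is cactus-compatible if: for all posets $P,Q$ with $|P|=p$, $|Q|=q$, every $D\in\mathfrak{D}_n$, $R=P\oplus D\oplus Q$, every linear extension $f$ of $R$, and all integers $1\le i$, $i+1<j<k\le p+n+q$, $(t_iq_{jk})^2(f)$ agrees with $f$ on $D$. -}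

module Defs where

open import Level using (0ℓ)
open import Data.Nat using (ℕ; zero; suc; _+_; _∸_; _≤_; _<_)
open import Data.Nat.Properties using (_≟_)
open import Data.Fin using (Fin; splitAt; _↑ˡ_; _↑ʳ_)
open import Data.Sum using (_⊎_; inj₁; inj₂)
open import Data.Product using (_×_; ∃)
open import Data.Unit using (⊤; tt)
open import Data.Empty using (⊥)
open import Data.Bool using (Bool; true; false; if_then_else_)
open import Data.List using (List)
open import Data.Bool.ListAction using (any)
open import Data.List.Base using (allFin)
open import Data.Bool using (_∨_; _∧_)
open import Relation.Nullary using (Dec; yes; no; ¬_)
open import Relation.Nullary.Decidable using (⌊_⌋)
open import Relation.Binary using (Rel; Decidable; IsStrictPartialOrder)
open import Relation.Binary.PropositionalEquality using (_≡_)
open import Data.Sum using () renaming (_⊎_ to _⊎′_)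
open import Data.Sum.Relation.Binary.Pointwise using ()

record FinPoset (N : ℕ) : Set₁ where
  field
    _<P_   : Rel (Fin N) 0ℓ
    isSPO  : IsStrictPartialOrder _≡_ _<P_
    _<P?_  : Decidable _<P_
open FinPoset public

record DecRel (N : ℕ) : Set₁ where
  field
    rel  : Rel (Fin N) 0ℓ
    rel? : Decidable rel
open DecRel public

toDecRel : ∀ {N} → FinPoset N → DecRel N
toDecRel P = record { rel = _<P_ P ; rel? = _<P?_ P }

⊕rel : ∀ {a b} → DecRel a → DecRel b → Rel (Fin (a + b)) 0ℓ
⊕rel {a} X Y x y with splitAt a x | splitAt a y
... | inj₁ u | inj₁ v = rel X u v
... | inj₁ u | inj₂ v = ⊤
... | inj₂ u | inj₁ v = ⊥
... | inj₂ u | inj₂ v = rel Y u v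

⊕rel? : ∀ {a b} (X : DecRel a) (Y : DecRel b) → Decidable (⊕rel X Y)
⊕rel? {a} X Y x y with splitAt a x | splitAt a y
... | inj₁ u | inj₁ v = rel? X u v
... | inj₁ u | inj₂ v = yes tt
... | inj₂ u | inj₁ v = no (λ ())
... | inj₂ u | inj₂ v = rel? Y u v

_⊕_ : ∀ {a b} → DecRel a → DecRel b → DecRel (a + b)
X ⊕ Y = record { rel = ⊕rel X Y ; rel? = ⊕rel? X Y }

antichain : (n : ℕ) → FinPoset n
antichain n = record
  { _<P_  = λ _ _ → ⊥
  ; isSPO = record
      { isEquivalence = Relation.Binary.PropositionalEquality.isEquivalence
      ; irrefl = λ _ ()
      ; trans = λ ()
      ; <-resp-≈ = (λ { Relation.Binary.PropositionalEquality.refl r → r })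
                 , (λ { Relation.Binary.PropositionalEquality.refl r → r }) }
  ; _<P?_ = λ _ _ → no (λ ()) }
  where open import Data.Product using (_,_)

C₁ : FinPoset 1
C₁ = antichain 1

C₁+C₁ : FinPoset 2
C₁+C₁ = antichain 2

Labelling : ℕ → Set
Labelling N = Fin N → ℕ

record IsLinExt {N : ℕ} (X : DecRel N) (f : Labelling N) : Set where
  field
    inRange    : ∀ x → 1 ≤ f x × f x ≤ N
    injective  : ∀ x y → f x ≡ f y → x ≡ y
    surjective : ∀ k → 1 ≤ k → k ≤ N → ∃ λ x → f x ≡ k
    monotone   : ∀ x y → rel X x y → f x < f y

comparableLabels : ∀ {N} → DecRel N → Labelling N → ℕ → Bool
comparableLabels {N} X f i =
  any (λ x → any (λ y →
        ⌊ f x ≟ i ⌋ ∧ ⌊ f y ≟ suc i ⌋ ∧ (⌊ rel? X x y ⌋ ∨ ⌊ rel? X y x ⌋))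
      (allFin N)) (allFin N)

swapLabel : ℕ → ℕ → ℕ
swapLabel i m with m ≟ i | m ≟ suc i
... | yes _ | _     = suc i
... | no _  | yes _ = i
... | no _  | no _  = m

t : ∀ {N} → DecRel N → ℕ → Labelling N → Labelling N
t X i f = if comparableLabels X f i then f else (λ x → swapLabel i (f x))

down : ∀ {N} → DecRel N → ℕ → Labelling N → Labelling N
down X zero    f = f
down X (suc i) f = t X (suc i) (down X i f)

-- q_0 = id, q_i = t_1 (t_2 t_1) ⋯ (t_i ⋯ t_1) = q_{i-1} ∘ (t_i ⋯ t_1)
q : ∀ {N} → DecRel N → ℕ → Labelling N → Labelling N
q X zero    f = f
q X (suc i) f = q X i (down X (suc i) f)

qjk : ∀ {N} → DecRel N → ℕ → ℕ → Labelling N → Labelling N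
qjk X j k f = q X (k ∸ 1) (q X (k ∸ j) (q X (k ∸ 1) f))

embD : ∀ {p n} q → Fin n → Fin ((p + n) + q)
embD {p} q d = (p ↑ʳ d) ↑ˡ q

CactusCompatible : (p n q : ℕ) → (FinPoset n → Set) → Set₁
CactusCompatible p n q 𝔇 =
  (P : FinPoset p) (Q : FinPoset q) (D : FinPoset n) → 𝔇 D →
  let R = (toDecRel P ⊕ toDecRel D) ⊕ toDecRel Q in
  (f : Labelling ((p + n) + q)) → IsLinExt R f →
  (i j k : ℕ) → 1 ≤ i → suc i < j → j < k → k ≤ (p + n) + q →
  (d : Fin n) →
  t R i (qjk R j k (t R i (qjk R j k f))) (embD q d) ≡ f (embD q d)

-- 𝔇_1 = {C_1}, 𝔇_2 = {C_1 + C_1}, up to isomorphism: a poset on Fin 1 (resp. Fin 2) is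
-- isomorphic to C_1 (resp. the 2-element antichain) iff its order relation is empty.
IsAntichain : ∀ {n} → FinPoset n → Set
IsAntichain D = ∀ x y → ¬ (_<P_ D x y)

𝔇₁ : FinPoset 1 → Set
𝔇₁ = IsAntichain

𝔇₂ : FinPoset 2 → Set
𝔇₂ = IsAntichain

-- Since all of P lies below D and all of Q above it, every linear extension of P ⊕ D ⊕ Q
-- gives D exactly the labels p + 1, …, p + n. Hence a Bender–Knuth move t_m leaves the labels
-- on D alone unless p < m < p + n, and inside that window it swaps the labels m and m + 1 on D,
-- since D is an antichain. For n ≤ 2 the window contains at most the move t_{p+1}, so every word
-- in the t_m acts on the labels of D as a power τᵇ of one transposition τ, and the square of such
-- a word, in particular of t_i q_jk, acts as τ²ᵇ = id.

module Submission where

open import Defs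
open import Data.Nat using (ℕ; zero; suc; _+_; _∸_; _≤_; _<_; z≤n; s≤s)
open import Data.Nat.Properties
open import Data.Bool using (Bool; true; false; T; _∧_; _∨_; _xor_; if_then_else_)
open import Data.Bool.Properties using (T-∧; T-∨; xor-same)
open import Data.Unit using (tt)
open import Data.Fin using (Fin; splitAt; _↑ˡ_; _↑ʳ_; fromℕ<; toℕ)
open import Data.Fin.Properties
  using (↑ˡ-injective; ↑ʳ-injective; splitAt-↑ˡ; splitAt-↑ʳ; splitAt⁻¹-↑ˡ; splitAt⁻¹-↑ʳ; injective⇒≤; toℕ-fromℕ<)
open import Data.List.Base using (allFin)
open import Data.List.Membership.Propositional using (lose)
open import Data.List.Membership.Propositional.Properties using (∈-allFin)
open import Data.List.Relation.Unary.Any using (satisfied)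
open import Data.List.Relation.Unary.Any.Properties using (any⁺; any⁻)
open import Data.Product using (_×_; _,_; ∃; ∃₂; proj₁; proj₂; uncurry)
open import Data.Sum using (_⊎_; inj₁; inj₂)
import Data.Sum as Sum
open import Function using (_∘_; id; Injective)
open import Function.Bundles using (Equivalence)
open import Relation.Nullary using (¬_; yes; no; contradiction)
open import Relation.Nullary.Decidable using (⌊_⌋; _×-dec_; fromWitness; toWitness)
open import Relation.Binary.PropositionalEquality

open Equivalence using (to; from)

data SwapLabelView (i : ℕ) : ℕ → ℕ → Set where
  at-i      : SwapLabelView i i (suc i)
  at-suc-i  : SwapLabelView i (suc i) i
  elsewhere : ∀ {m} → m ≢ i → m ≢ suc i → SwapLabelView i m m

swapLabel-view : ∀ i m → SwapLabelView i m (swapLabel i m)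
swapLabel-view i m with m ≟ i | m ≟ suc i
... | yes refl | _        = at-i
... | no _     | yes refl = at-suc-i
... | no m≢i   | no m≢1+i = elsewhere m≢i m≢1+i

swapLabel-at-i : ∀ i → swapLabel i i ≡ suc i
swapLabel-at-i i with i ≟ i
... | yes _   = refl
... | no i≢i  = contradiction refl i≢i

swapLabel-at-suc-i : ∀ i → swapLabel i (suc i) ≡ i
swapLabel-at-suc-i i with suc i ≟ i | suc i ≟ suc i
... | yes 1+i≡i | _ = contradiction 1+i≡i 1+n≢n
... | no _ | yes _  = refl
... | no _ | no ne  = contradiction refl ne

swapLabel-elsewhere : ∀ {i m} → m ≢ i → m ≢ suc i → swapLabel i m ≡ m
swapLabel-elsewhere {i} {m} m≢i m≢1+i with m ≟ i | m ≟ suc i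
... | yes m≡i | _         = contradiction m≡i m≢i
... | no _    | yes m≡1+i = contradiction m≡1+i m≢1+i
... | no _    | no _      = refl

swapLabel-involutive : ∀ i m → swapLabel i (swapLabel i m) ≡ m
swapLabel-involutive i m with swapLabel i m | swapLabel-view i m
... | _ | at-i                = swapLabel-at-suc-i i
... | _ | at-suc-i            = swapLabel-at-i i
... | _ | elsewhere m≢i m≢1+i = swapLabel-elsewhere m≢i m≢1+i

swapLabel-injective : ∀ i → Injective _≡_ _≡_ (swapLabel i)
swapLabel-injective i {a} {b} eq = begin
  a                               ≡⟨ swapLabel-involutive i a ⟨
  swapLabel i (swapLabel i a)     ≡⟨ cong (swapLabel i) eq ⟩
  swapLabel i (swapLabel i b)     ≡⟨ swapLabel-involutive i b ⟩
  b                               ∎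
  where open ≡-Reasoning

swapLabel-< : ∀ {i a b} → a < b → ¬ (a ≡ i × b ≡ suc i) → swapLabel i a < swapLabel i b
swapLabel-< {i} {a} {b} a<b ¬pair
  with swapLabel i a | swapLabel-view i a | swapLabel i b | swapLabel-view i b
... | _ | at-i            | _ | at-i              = contradiction a<b (<-irrefl refl)
... | _ | at-i            | _ | at-suc-i          = contradiction (refl , refl) ¬pair
... | _ | at-i            | _ | elsewhere _ b≢1+i = ≤∧≢⇒< a<b (b≢1+i ∘ sym)
... | _ | at-suc-i        | _ | at-i              = contradiction a<b (<-asym (n<1+n i))
... | _ | at-suc-i        | _ | at-suc-i          = contradiction a<b (<-irrefl refl)
... | _ | at-suc-i        | _ | elsewhere _ _     = <-trans (n<1+n i) a<b
... | _ | elsewhere _ _   | _ | at-i              = m<n⇒m<1+n a<b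
... | _ | elsewhere a≢i _ | _ | at-suc-i          = ≤∧≢⇒< (≤-pred a<b) a≢i
... | _ | elsewhere _ _   | _ | elsewhere _ _     = a<b

swapLabel-inRange : ∀ {i N v} → 1 ≤ i → i < N → 1 ≤ v × v ≤ N →
                    1 ≤ swapLabel i v × swapLabel i v ≤ N
swapLabel-inRange {i} {N} {v} 1≤i i<N v∈ with swapLabel i v | swapLabel-view i v
... | _ | at-i          = s≤s z≤n , i<N
... | _ | at-suc-i      = 1≤i , <⇒≤ i<N
... | _ | elsewhere _ _ = v∈

swapLabel-fixes-outside : ∀ {i lo hi v} → lo < v → lo < swapLabel i v →
                          swapLabel i v ≤ hi → v ≤ hi →
                          ¬ (lo < i × i < hi) → swapLabel i v ≡ v
swapLabel-fixes-outside {i} {lo} {hi} {v} lo<v lo<v′ v′≤hi v≤hi outside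
  with swapLabel i v | swapLabel-view i v
... | _ | at-i          = contradiction (lo<v , v′≤hi) outside
... | _ | at-suc-i      = contradiction (lo<v′ , v≤hi) outside
... | _ | elsewhere _ _ = refl

module _ {N : ℕ} (X : DecRel N) where

  Comparable : Fin N → Fin N → Set
  Comparable x y = rel X x y ⊎ rel X y x

  labelledPair? : Labelling N → ℕ → Fin N → Fin N → Bool
  labelledPair? f m x y =
    ⌊ f x ≟ m ⌋ ∧ ⌊ f y ≟ suc m ⌋ ∧ (⌊ rel? X x y ⌋ ∨ ⌊ rel? X y x ⌋)

  labelledPair?-complete : ∀ {f m x y} → f x ≡ m → f y ≡ suc m → Comparable x y →
                           T (labelledPair? f m x y)
  labelledPair?-complete {f} {m} {x} {y} fx≡m fy≡1+m x∼y =
    from (T-∧ {⌊ f x ≟ m ⌋}) (fromWitness fx≡m , from (T-∧ {⌊ f y ≟ suc m ⌋})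
      (fromWitness fy≡1+m , from (T-∨ {⌊ rel? X x y ⌋})
        (Sum.map fromWitness fromWitness x∼y)))

  labelledPair?-sound : ∀ {f m x y} → T (labelledPair? f m x y) →
                        f x ≡ m × f y ≡ suc m × Comparable x y
  labelledPair?-sound {f} {m} {x} {y} p =
    let fx≡m , p′ = to (T-∧ {⌊ f x ≟ m ⌋}) p
        fy≡1+m , x∼y = to (T-∧ {⌊ f y ≟ suc m ⌋}) p′
    in  toWitness fx≡m , toWitness fy≡1+m ,
        Sum.map toWitness toWitness (to (T-∨ {⌊ rel? X x y ⌋}) x∼y)

  comparableLabels⁺ : ∀ {f m x y} → f x ≡ m → f y ≡ suc m → Comparable x y →
                      T (comparableLabels X f m)
  comparableLabels⁺ {f} {m} {x} {y} fx≡m fy≡1+m x∼y =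
    any⁺ _ (lose (∈-allFin x) (any⁺ (labelledPair? f m x) (lose (∈-allFin y)
      (labelledPair?-complete fx≡m fy≡1+m x∼y))))

  comparableLabels⁻ : ∀ {f m} → T (comparableLabels X f m) →
                      ∃₂ λ x y → f x ≡ m × f y ≡ suc m × Comparable x y
  comparableLabels⁻ {f} {m} c =
    let x , c′ = satisfied (any⁻ _ (allFin N) c)
        y , c″ = satisfied (any⁻ (labelledPair? f m x) (allFin N) c′)
    in x , y , labelledPair?-sound {f} {m} {x} {y} c″

  PreservesLinExt : (Labelling N → Labelling N) → Set
  PreservesLinExt F = ∀ f → IsLinExt X f → IsLinExt X (F f)

  t-preservesLinExt : ∀ {m} → 1 ≤ m → m < N → PreservesLinExt (t X m)
  t-preservesLinExt {m} 1≤m m<N f L with comparableLabels X f m in c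
  ... | true  = L
  ... | false = record
    { inRange    = λ x → swapLabel-inRange 1≤m m<N (inRange x)
    ; injective  = λ x y → injective x y ∘ swapLabel-injective m
    ; surjective = λ k 1≤k k≤N →
        let x , fx≡ = uncurry (surjective (swapLabel m k)) (swapLabel-inRange 1≤m m<N (1≤k , k≤N))
        in  x , trans (cong (swapLabel m) fx≡) (swapLabel-involutive m k)
    ; monotone   = λ x y x<y → swapLabel-< (monotone x y x<y) λ (fx≡m , fy≡1+m) →
        subst T c (comparableLabels⁺ fx≡m fy≡1+m (inj₁ x<y))
    }
    where open IsLinExt L

injection-into-interval : ∀ {a lo hi} (h : Fin a → ℕ) → Injective _≡_ _≡_ h →
                          (∀ u → lo ≤ h u × h u < hi) → a ≤ hi ∸ lo
injection-into-interval {a} {lo} {hi} h h-injective h∈ = injective⇒≤ shift-injective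
  where
  shift : Fin a → Fin (hi ∸ lo)
  shift u = fromℕ< (∸-monoˡ-< (proj₂ (h∈ u)) (proj₁ (h∈ u)))

  shift-injective : Injective _≡_ _≡_ shift
  shift-injective {u} {v} eq = h-injective (∸-cancelʳ-≡ (proj₁ (h∈ u)) (proj₁ (h∈ v)) (begin
    h u ∸ lo        ≡⟨ toℕ-fromℕ< _ ⟨
    toℕ (shift u)   ≡⟨ cong toℕ eq ⟩
    toℕ (shift v)   ≡⟨ toℕ-fromℕ< _ ⟩
    h v ∸ lo        ∎))
    where open ≡-Reasoning

module _ {a b} {X : DecRel a} {Y : DecRel b} where

  ⊕-rel-↑ˡ : ∀ u v → rel (X ⊕ Y) (u ↑ˡ b) (v ↑ˡ b) ≡ rel X u v
  ⊕-rel-↑ˡ u v rewrite splitAt-↑ˡ a u b | splitAt-↑ˡ a v b = refl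

  ⊕-rel-↑ʳ : ∀ u v → rel (X ⊕ Y) (a ↑ʳ u) (a ↑ʳ v) ≡ rel Y u v
  ⊕-rel-↑ʳ u v rewrite splitAt-↑ʳ a b u | splitAt-↑ʳ a b v = refl

  ⊕-rel-↑ˡ-↑ʳ : ∀ u v → rel (X ⊕ Y) (u ↑ˡ b) (a ↑ʳ v)
  ⊕-rel-↑ˡ-↑ʳ u v rewrite splitAt-↑ˡ a u b | splitAt-↑ʳ a b v = tt

  module _ {f : Labelling (a + b)} (L : IsLinExt (X ⊕ Y) f) where
    open IsLinExt L

    ⊕-linExt-↑ʳ : ∀ v → a < f (a ↑ʳ v)
    ⊕-linExt-↑ʳ v = subst (_≤ f (a ↑ʳ v)) (+-comm a 1)
      (m≤o∸n⇒m+n≤o a (proj₁ (inRange (a ↑ʳ v)))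
        (injection-into-interval (λ u → f (u ↑ˡ b)) (↑ˡ-injective b _ _ ∘ injective _ _)
          (λ u → proj₁ (inRange (u ↑ˡ b)) , monotone _ _ (⊕-rel-↑ˡ-↑ʳ u v))))

    ⊕-linExt-↑ˡ : ∀ u → f (u ↑ˡ b) ≤ a
    ⊕-linExt-↑ˡ u = +-cancelʳ-≤ b (f (u ↑ˡ b)) a
      (subst (_≤ a + b) (+-comm b (f (u ↑ˡ b)))
        (m≤o∸n⇒m+n≤o b (proj₂ (inRange (u ↑ˡ b)))
          (injection-into-interval (λ w → f (a ↑ʳ w)) (↑ʳ-injective a _ _ ∘ injective _ _)
            (λ w → monotone _ _ (⊕-rel-↑ˡ-↑ʳ u w) , s≤s (proj₂ (inRange (a ↑ʳ w)))))))

    ⊕-linExt-restrictˡ : IsLinExt X (λ u → f (u ↑ˡ b))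
    ⊕-linExt-restrictˡ = record
      { inRange    = λ u → proj₁ (inRange (u ↑ˡ b)) , ⊕-linExt-↑ˡ u
      ; injective  = λ u v → ↑ˡ-injective b u v ∘ injective _ _
      ; surjective = surjectiveˡ
      ; monotone   = λ u v → monotone _ _ ∘ subst id (sym (⊕-rel-↑ˡ u v))
      }
      where
      surjectiveˡ : ∀ k → 1 ≤ k → k ≤ a → ∃ λ u → f (u ↑ˡ b) ≡ k
      surjectiveˡ k 1≤k k≤a with surjective k 1≤k (≤-trans k≤a (m≤m+n a b))
      ... | x , fx≡k with splitAt a x in split
      ...   | inj₁ u = u , trans (cong f (splitAt⁻¹-↑ˡ split)) fx≡k
      ...   | inj₂ v = contradiction (subst (a <_) (trans (cong f (splitAt⁻¹-↑ʳ split)) fx≡k)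
                                            (⊕-linExt-↑ʳ v)) (≤⇒≯ k≤a)

module Middle {p n q} (P : DecRel p) (D : DecRel n) (Q : DecRel q) where

  R : DecRel ((p + n) + q)
  R = (P ⊕ D) ⊕ Q

  eD : Fin n → Fin ((p + n) + q)
  eD = embD q

  module _ {f : Labelling ((p + n) + q)} (L : IsLinExt R f) where

    D-labels-above-P : ∀ d → p < f (eD d)
    D-labels-above-P = ⊕-linExt-↑ʳ (⊕-linExt-restrictˡ L)

    D-labels-below-Q : ∀ d → f (eD d) ≤ p + n
    D-labels-below-Q d = ⊕-linExt-↑ˡ L (p ↑ʳ d)

    middle-label⇒D : ∀ {x} → p < f x → f x ≤ p + n → ∃ λ d → eD d ≡ x
    middle-label⇒D {x} p<fx fx≤p+n with splitAt (p + n) x in split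
    ... | inj₂ w = contradiction
        (subst (λ y → p + n < f y) (splitAt⁻¹-↑ʳ split) (⊕-linExt-↑ʳ L w))
        (≤⇒≯ fx≤p+n)
    ... | inj₁ u with splitAt p u in split′
    ...   | inj₁ v = contradiction
        (subst (λ y → f y ≤ p) (trans (cong (_↑ˡ q) (splitAt⁻¹-↑ˡ split′)) (splitAt⁻¹-↑ˡ split))
               (⊕-linExt-↑ˡ (⊕-linExt-restrictˡ L) v))
        (<⇒≱ p<fx)
    ...   | inj₂ d = d , trans (cong (_↑ˡ q) (splitAt⁻¹-↑ʳ split′)) (splitAt⁻¹-↑ˡ split)

  rel-D : ∀ d d′ → rel R (eD d) (eD d′) ≡ rel D d d′
  rel-D d d′ = trans (⊕-rel-↑ˡ {Y = Q} (p ↑ʳ d) (p ↑ʳ d′)) (⊕-rel-↑ʳ {X = P} d d′)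

  t-fixes-D : ∀ {m} → 1 ≤ m → m < (p + n) + q → ¬ (p < m × m < p + n) →
              ∀ f → IsLinExt R f → ∀ d → t R m f (eD d) ≡ f (eD d)
  t-fixes-D {m} 1≤m m<N outside f L d
    with comparableLabels R f m | t-preservesLinExt R 1≤m m<N f L
  ... | true  | _  = refl
  -- The swapped labelling is again a linear extension, so D keeps its labels in (p, p + n].
  ... | false | L′ = swapLabel-fixes-outside (D-labels-above-P L d) (D-labels-above-P L′ d)
                       (D-labels-below-Q L′ d) (D-labels-below-Q L d) outside

  swapIf : Bool → ℕ → ℕ
  swapIf b = if b then swapLabel (suc p) else id

  swapIf-xor : ∀ a b v → swapIf a (swapIf b v) ≡ swapIf (a xor b) v
  swapIf-xor false b     v = refl
  swapIf-xor true  false v = refl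
  swapIf-xor true  true  v = swapLabel-involutive (suc p) v

  record ActsOnD (F : Labelling ((p + n) + q) → Labelling ((p + n) + q)) : Set where
    field
      preservesLinExt : PreservesLinExt R F
      parity          : Bool
      onD             : ∀ f → IsLinExt R f → ∀ d → F f (eD d) ≡ swapIf parity (f (eD d))

  id-actsOnD : ActsOnD id
  id-actsOnD = record { preservesLinExt = λ _ L → L ; parity = false ; onD = λ _ _ _ → refl }

  ∘-actsOnD : ∀ {F G} → ActsOnD F → ActsOnD G → ActsOnD (F ∘ G)
  ∘-actsOnD {F} {G} actF actG = record
    { preservesLinExt = λ f → F.preservesLinExt (G f) ∘ G.preservesLinExt f
    ; parity          = F.parity xor G.parity
    ; onD             = λ f L d → begin
        F (G f) (eD d)                                ≡⟨ F.onD (G f) (G.preservesLinExt f L) d ⟩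
        swapIf F.parity (G f (eD d))                  ≡⟨ cong (swapIf F.parity) (G.onD f L d) ⟩
        swapIf F.parity (swapIf G.parity (f (eD d)))  ≡⟨ swapIf-xor F.parity G.parity (f (eD d)) ⟩
        swapIf (F.parity xor G.parity) (f (eD d))     ∎
    }
    where
    module F = ActsOnD actF
    module G = ActsOnD actG
    open ≡-Reasoning

  actsOnD-square : ∀ {F} → ActsOnD F → ∀ f → IsLinExt R f → ∀ d → F (F f) (eD d) ≡ f (eD d)
  actsOnD-square actF f L d =
    trans (ActsOnD.onD (∘-actsOnD actF actF) f L d)
          (cong (λ b → swapIf b (f (eD d))) (xor-same (ActsOnD.parity actF)))

  module _ (antichain : ∀ d d′ → ¬ rel D d d′) where

    middle-labels-incomparable : ∀ {m f} → IsLinExt R f → p < m → m < p + n →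
                                 ¬ T (comparableLabels R f m)
    middle-labels-incomparable {m} {f} L p<m m<p+n c with comparableLabels⁻ R c
    ... | x , y , fx≡m , fy≡1+m , x∼y
      with middle-label⇒D L (subst (p <_) (sym fx≡m) p<m)
                            (subst (_≤ p + n) (sym fx≡m) (<⇒≤ m<p+n))
         | middle-label⇒D L (subst (p <_) (sym fy≡1+m) (m<n⇒m<1+n p<m))
                            (subst (_≤ p + n) (sym fy≡1+m) m<p+n)
    ... | d , refl | d′ , refl =
      Sum.[ antichain d d′ ∘ subst id (rel-D d d′)
          , antichain d′ d ∘ subst id (rel-D d′ d) ] x∼y

    t-swaps-D : ∀ {m} → p < m → m < p + n →
                ∀ f → IsLinExt R f → ∀ d → t R m f (eD d) ≡ swapLabel m (f (eD d))
    t-swaps-D {m} p<m m<p+n f L d with comparableLabels R f m in c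
    ... | false = refl
    ... | true  = contradiction (subst T (sym c) tt) (middle-labels-incomparable L p<m m<p+n)

    module Narrow (n≤2 : n ≤ 2) where

      t-actsOnD : ∀ {m} → 1 ≤ m → m < (p + n) + q → ActsOnD (t R m)
      t-actsOnD {m} 1≤m m<N with p <? m ×-dec m <? p + n
      ... | yes (p<m , m<p+n) = record
        { preservesLinExt = t-preservesLinExt R 1≤m m<N
        ; parity          = true
        ; onD             = λ f L d → trans (t-swaps-D p<m m<p+n f L d)
                                            (cong (λ i → swapLabel i (f (eD d))) m≡1+p)
        }
        where
        m≡1+p : m ≡ suc p
        m≡1+p = ≤-antisym (≤-pred (begin-strict
            m      <⟨ m<p+n ⟩
            p + n  ≤⟨ +-monoʳ-≤ p n≤2 ⟩
            p + 2  ≡⟨ +-comm p 2 ⟩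
            2 + p  ∎)) p<m
          where open ≤-Reasoning
      ... | no outside = record
        { preservesLinExt = t-preservesLinExt R 1≤m m<N
        ; parity          = false
        ; onD             = t-fixes-D 1≤m m<N outside
        }

      down-actsOnD : ∀ {m} → m < (p + n) + q → ActsOnD (down R m)
      down-actsOnD {zero}  _   = id-actsOnD
      down-actsOnD {suc m} m<N =
        ∘-actsOnD (t-actsOnD (s≤s z≤n) m<N) (down-actsOnD (<-trans (n<1+n m) m<N))

      q-actsOnD : ∀ {m} → m < (p + n) + q → ActsOnD (Defs.q R m)
      q-actsOnD {zero}  _   = id-actsOnD
      q-actsOnD {suc m} m<N =
        ∘-actsOnD (q-actsOnD (<-trans (n<1+n m) m<N)) (down-actsOnD m<N)

      qjk-actsOnD : ∀ {j k} → 1 ≤ j → 1 ≤ k → k ≤ (p + n) + q → ActsOnD (qjk R j k)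
      qjk-actsOnD {j} {suc k} 1≤j _ k<N =
        ∘-actsOnD (q-actsOnD k<N)
          (∘-actsOnD (q-actsOnD (≤-<-trans (∸-monoʳ-≤ (suc k) 1≤j) k<N)) (q-actsOnD k<N))

cactusCompatible-antichain : ∀ {p n q} → n ≤ 2 → CactusCompatible p n q IsAntichain
cactusCompatible-antichain {p} {n} {q} n≤2 P Q D antichain f L i j k 1≤i 1+i<j j<k k≤N =
  actsOnD-square (∘-actsOnD (t-actsOnD 1≤i i<N) (qjk-actsOnD 1≤j 1≤k k≤N)) f L
  where
  open Middle (toDecRel P) (toDecRel D) (toDecRel Q)
  open Narrow antichain n≤2
  i<N : i < (p + n) + q
  i<N = ≤-trans (<⇒≤ (<-trans 1+i<j j<k)) k≤N
  1≤j : 1 ≤ j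
  1≤j = ≤-trans (s≤s z≤n) 1+i<j
  1≤k : 1 ≤ k
  1≤k = ≤-trans 1≤j (<⇒≤ j<k)

proposition4p13 : (p q : ℕ) → CactusCompatible p 1 q 𝔇₁ × CactusCompatible p 2 q 𝔇₂
proposition4p13 p q = cactusCompatible-antichain (s≤s z≤n) , cactusCompatible-antichain ≤-refl
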